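{- Let $(G, l, I_{\mathrm{ini}})$ be an instance of Opt-ISR such that $G$ is a chordal graph, and let $I_{\max}$ be any maximum independent set of $G$. Then, a solution $I_{\mathrm{opt}}$ to $(G, l, I_{\mathrm{ini}})$ can be obtained as follows: $I_{\mathrm{opt}} = I_{\mathrm{ini}}$ if $I_{\mathrm{ini}}$ is a maximal independent set of $G$ and $|I_{\mathrm{ini}}| = l$; and $I_{\mathrm{opt}} = I_{\max}$ otherwise.
   Context: For an integer $l \ge 0$, two independent sets $I_p, I_q$ of a graph $G$ with $|I_p|, |I_q| \ge l$ are reachable under the $\mathsf{TAR}(l)$ rule if there is a sequence $\langle I_1, \ldots, I_\ell \rangle$ of independent sets of $G$ with $I_1 = I_p$, $I_\ell = I_q$, $|I_i| \ge l$ for all $i$, and $|I_i \triangle I_{i+1}| = 1$ for all $i$. Opt-ISR: given an instance $(G, l, I_{\mathrm{ini}})$ consisting of a graph $G$, an integer $l \ge 0$, and an independent set $I_{\mathrm{ini}}$ of $G$ with $|I_{\mathrm{ini}}| \ge l$, find an independent set $I_{\mathrm{opt}}$ (a solution) of $G$ reachable from $I_{\mathrm{ini}}$ under the $\mathsf{TAR}(l)$ rule such that $|I_{\mathrm{opt}}|$ is maximized. A graph is chordal if every induced cycle in it has length three. -}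

module Defs where

open import Data.Nat using (ℕ; suc; _≤_; _≥_)
open import Data.Fin using (Fin; toℕ)
open import Data.Fin.Subset using (Subset; _∈_; _∉_; _∪_; _─_; ∣_∣; ⁅_⁆)
open import Data.Bool using (Bool; true; false)
open import Data.Product using (_×_; Σ)
open import Data.Sum using (_⊎_)
open import Relation.Binary.PropositionalEquality using (_≡_; _≢_)
open import Relation.Nullary using (¬_)
open import Function.Definitions using (Injective)

record Graph (n : ℕ) : Set where
  field
    adj     : Fin n → Fin n → Bool
    sym     : ∀ u v → adj u v ≡ adj v u
    irrefl  : ∀ v → adj v v ≡ false

open Graph public

Independent : ∀ {n} → Graph n → Subset n → Set
Independent G I = ∀ u v → u ∈ I → v ∈ I → adj G u v ≡ false

MaximalIndependent : ∀ {n} → Graph n → Subset n → Set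
MaximalIndependent G I =
  Independent G I × (∀ v → v ∉ I → ¬ Independent G (I ∪ ⁅ v ⁆))

MaximumIndependent : ∀ {n} → Graph n → Subset n → Set
MaximumIndependent G I =
  Independent G I × (∀ J → Independent G J → ∣ J ∣ ≤ ∣ I ∣)

CycNext : ∀ {k} → Fin k → Fin k → Set
CycNext {k} i j = (toℕ j ≡ suc (toℕ i)) ⊎ ((suc (toℕ i) ≡ k) × (toℕ j ≡ 0))

CycAdj : ∀ {k} → Fin k → Fin k → Set
CycAdj i j = CycNext i j ⊎ CycNext j i

record InducedCycle {n} (G : Graph n) (k : ℕ) : Set where
  field
    k≥3   : k ≥ 3
    c     : Fin k → Fin n
    inj   : Injective _≡_ _≡_ c
    edges : ∀ i j → CycAdj i j → adj G (c i) (c j) ≡ true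
    nonedges : ∀ i j → i ≢ j → ¬ CycAdj i j → adj G (c i) (c j) ≡ false

Chordal : ∀ {n} → Graph n → Set
Chordal G = ∀ k → InducedCycle G k → k ≡ 3

_△_ : ∀ {n} → Subset n → Subset n → Subset n
I △ J = (I ─ J) ∪ (J ─ I)

data Reach {n} (G : Graph n) (l : ℕ) (I : Subset n) : Subset n → Set where
  start : Independent G I → l ≤ ∣ I ∣ → Reach G l I I
  step  : ∀ {J K} → Reach G l I J → Independent G K → l ≤ ∣ K ∣ →
          ∣ J △ K ∣ ≡ 1 → Reach G l I K

Solution : ∀ {n} → Graph n → ℕ → Subset n → Subset n → Set
Solution G l Iini I =
  Reach G l Iini I × (∀ J → Reach G l Iini J → ∣ J ∣ ≤ ∣ I ∣)

-- If Iini is a maximal independent set of size l, nothing can be added to it and nothing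
-- removed, so it is the only reachable set. Otherwise one step reaches a set of size ≥ l + 1,
-- and from any independent I with |I| ≥ l + 1 every independent J with |J| ≥ l + 1 (such as
-- Imax) is reachable by moves that shrink |I △ J|: add a vertex of J with no neighbour in I,
-- drop a vertex of I ∖ J while |I| ≥ l + 2, and otherwise bring in some a ∈ J ∖ I with at most
-- one neighbour in I ∖ J (hence in I), removing that neighbour first. Such an a exists because
-- |I ∖ J| ≤ |J ∖ I| and, in a chordal graph, for independent A, B with |B| ≤ |A| some vertex
-- of A has at most one neighbour in B. This goes by induction on |B|, deleting a vertex of B
-- with at most one neighbour in A together with that neighbour; such a vertex exists unless
-- every vertex of A ∪ B has two neighbours on the other side. That is impossible: a
-- triangle-free vertex set of minimum degree 2 in a chordal graph would contain induced paths
-- of every length, since prepending a neighbour of the first vertex either extends the path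
-- or, at the first later vertex it is adjacent to, closes an induced cycle, which chordality
-- forces to be a triangle.

module Submission where

open import Defs hiding (sym)
open import Data.Bool using (true; false)
import Data.Bool as Bool
open import Data.Bool.Properties using (¬-not)
open import Data.Empty using (⊥-elim)
open import Data.Fin using (Fin; zero; suc; toℕ; _≟_)
open import Data.Fin.Properties using (any?; all?; toℕ-injective; toℕ<n; injective⇒≤)
open import Data.Fin.Subset
open import Data.Fin.Subset.Properties
open import Data.Nat using (ℕ; suc; _+_; _≤_; _<_; z≤n; s≤s; z<s)
open import Data.Nat.Induction using (<-wellFounded)
open import Data.Nat.Properties hiding (_≟_)
open import Data.Product using (_×_; _,_; ∃; ∃₂; proj₁; proj₂)
open import Data.Sum using (_⊎_; inj₁; inj₂)
open import Data.Vec using ([]; _∷_; here; there)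
open import Function using (_∘_; case_of_)
open import Induction.WellFounded using (Acc; acc)
open import Relation.Binary.Definitions using (tri<; tri≈; tri>)
open import Relation.Binary.PropositionalEquality
open import Relation.Nullary using (¬_; Dec; yes; no; contradiction)
open import Relation.Nullary.Decidable using (decidable-stable; _×-dec_; _→-dec_; ¬?)
open import Relation.Unary using (Decidable)

private variable
  n : ℕ
  x y : Fin n
  p q p′ : Subset n

x∈p─q⁻ : ∀ (p q : Subset n) → x ∈ p ─ q → x ∈ p × x ∉ q
x∈p─q⁻ (true  ∷ p) (false ∷ q) here = here , λ ()
x∈p─q⁻ {x = zero} (true  ∷ p) (true  ∷ q) ()
x∈p─q⁻ {x = zero} (false ∷ p) (true  ∷ q) ()
x∈p─q⁻ {x = zero} (false ∷ p) (false ∷ q) ()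
x∈p─q⁻ (_ ∷ p) (_ ∷ q) (there x∈) =
  let x∈p , x∉q = x∈p─q⁻ p q x∈ in there x∈p , λ x∈q → x∉q (drop-there x∈q)

x∈p-y⁻ : ∀ (p : Subset n) → x ∈ p - y → x ∈ p × x ≢ y
x∈p-y⁻ {y = y} p x∈ = let x∈p , x∉⁅y⁆ = x∈p─q⁻ p ⁅ y ⁆ x∈ in x∈p , x∉⁅y⁆⇒x≢y x∉⁅y⁆

x∈p∪⁅y⁆⁻ : ∀ (p : Subset n) → x ∈ p ∪ ⁅ y ⁆ → x ∈ p ⊎ x ≡ y
x∈p∪⁅y⁆⁻ {y = y} p x∈ = Data.Sum.map₂ (x∈⁅y⁆⇒x≡y y) (x∈p∪q⁻ p ⁅ y ⁆ x∈)

x∈p△q⁻ : ∀ (p q : Subset n) → x ∈ p △ q → (x ∈ p × x ∉ q) ⊎ (x ∈ q × x ∉ p)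
x∈p△q⁻ p q x∈ = Data.Sum.map (x∈p─q⁻ p q) (x∈p─q⁻ q p) (x∈p∪q⁻ (p ─ q) (q ─ p) x∈)

x∈p△q⁺ : (x ∈ p × x ∉ q) ⊎ (x ∈ q × x ∉ p) → x ∈ p △ q
x∈p△q⁺ (inj₁ (x∈p , x∉q)) = x∈p∪q⁺ (inj₁ (x∈p∧x∉q⇒x∈p─q x∈p x∉q))
x∈p△q⁺ (inj₂ (x∈q , x∉p)) = x∈p∪q⁺ (inj₂ (x∈p∧x∉q⇒x∈p─q x∈q x∉p))

∣p∪⁅x⁆∣≡1+∣p∣ : ∀ (p : Subset n) → x ∉ p → ∣ p ∪ ⁅ x ⁆ ∣ ≡ suc ∣ p ∣
∣p∪⁅x⁆∣≡1+∣p∣ {x = zero}  (true  ∷ p) x∉p = contradiction here x∉p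
∣p∪⁅x⁆∣≡1+∣p∣ {x = zero}  (false ∷ p) _   = cong (suc ∘ ∣_∣) (∪-identityʳ p)
∣p∪⁅x⁆∣≡1+∣p∣ {x = suc x} (true  ∷ p) x∉p = cong suc (∣p∪⁅x⁆∣≡1+∣p∣ p (x∉p ∘ there))
∣p∪⁅x⁆∣≡1+∣p∣ {x = suc x} (false ∷ p) x∉p = ∣p∪⁅x⁆∣≡1+∣p∣ p (x∉p ∘ there)

1+∣p-x∣≡∣p∣ : ∀ (p : Subset n) → x ∈ p → suc ∣ p - x ∣ ≡ ∣ p ∣
1+∣p-x∣≡∣p∣ (true  ∷ p) here        = cong (suc ∘ ∣_∣) (p─⊥≡p p)
1+∣p-x∣≡∣p∣ (true  ∷ p) (there x∈p) = cong suc (1+∣p-x∣≡∣p∣ p x∈p)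
1+∣p-x∣≡∣p∣ (false ∷ p) (there x∈p) = 1+∣p-x∣≡∣p∣ p x∈p

∣p─q∣+∣p∩q∣≡∣p∣ : ∀ (p q : Subset n) → ∣ p ─ q ∣ + ∣ p ∩ q ∣ ≡ ∣ p ∣
∣p─q∣+∣p∩q∣≡∣p∣ []          []          = refl
∣p─q∣+∣p∩q∣≡∣p∣ (true  ∷ p) (true  ∷ q) = trans (+-suc _ _) (cong suc (∣p─q∣+∣p∩q∣≡∣p∣ p q))
∣p─q∣+∣p∩q∣≡∣p∣ (true  ∷ p) (false ∷ q) = cong suc (∣p─q∣+∣p∩q∣≡∣p∣ p q)
∣p─q∣+∣p∩q∣≡∣p∣ (false ∷ p) (true  ∷ q) = ∣p─q∣+∣p∩q∣≡∣p∣ p q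
∣p─q∣+∣p∩q∣≡∣p∣ (false ∷ p) (false ∷ q) = ∣p─q∣+∣p∩q∣≡∣p∣ p q

∣p∣≤∣q∣⇒∣p─q∣≤∣q─p∣ : ∀ (p q : Subset n) → ∣ p ∣ ≤ ∣ q ∣ → ∣ p ─ q ∣ ≤ ∣ q ─ p ∣
∣p∣≤∣q∣⇒∣p─q∣≤∣q─p∣ p q ∣p∣≤∣q∣ = +-cancelʳ-≤ (∣ p ∩ q ∣) (∣ p ─ q ∣) (∣ q ─ p ∣) (begin
  ∣ p ─ q ∣ + ∣ p ∩ q ∣ ≡⟨ ∣p─q∣+∣p∩q∣≡∣p∣ p q ⟩
  ∣ p ∣                 ≤⟨ ∣p∣≤∣q∣ ⟩
  ∣ q ∣                 ≡⟨ ∣p─q∣+∣p∩q∣≡∣p∣ q p ⟨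
  ∣ q ─ p ∣ + ∣ q ∩ p ∣ ≡⟨ cong (λ r → ∣ q ─ p ∣ + ∣ r ∣) (∩-comm q p) ⟩
  ∣ q ─ p ∣ + ∣ p ∩ q ∣ ∎)
  where open ≤-Reasoning

x∈p⇒0<∣p∣ : x ∈ p → 0 < ∣ p ∣
x∈p⇒0<∣p∣ x∈p = ≤-<-trans z≤n (x∈p⇒∣p-x∣<∣p∣ x∈p)

0<∣p∣⇒Nonempty : ∀ (p : Subset n) → 0 < ∣ p ∣ → Nonempty p
0<∣p∣⇒Nonempty {n} p 0<∣p∣ with nonempty? p
... | yes ne = ne
... | no  ∅  = contradiction (trans (cong ∣_∣ (Empty-unique ∅)) (∣⊥∣≡0 n)) (>⇒≢ 0<∣p∣)

∣p∣≤1⇒x≡y : ∣ p ∣ ≤ 1 → x ∈ p → y ∈ p → x ≡ y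
∣p∣≤1⇒x≡y {x = x} {y} ∣p∣≤1 x∈p y∈p with x ≟ y
... | yes x≡y = x≡y
... | no  x≢y = contradiction (≤-trans (x∈p⇒∣p-x∣<∣p∣ x∈p) ∣p∣≤1)
                  (≤⇒≯ (x∈p⇒0<∣p∣ (x∈p∧x≢y⇒x∈p-y y∈p (x≢y ∘ sym))))

Empty[p─q]⇒p⊆q : ∀ (p q : Subset n) → Empty (p ─ q) → p ⊆ q
Empty[p─q]⇒p⊆q p q ∅ {x} x∈p =
  decidable-stable (x ∈? q) λ x∉q → ∅ (x , x∈p∧x∉q⇒x∈p─q x∈p x∉q)

AgreeOff : Fin n → Subset n → Subset n → Set
AgreeOff x p p′ = ∀ {y} → y ≢ x → (y ∈ p → y ∈ p′) × (y ∈ p′ → y ∈ p)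

agreeOff-∪⁅x⁆ : ∀ (p : Subset n) → AgreeOff x p (p ∪ ⁅ x ⁆)
agreeOff-∪⁅x⁆ p y≢x =
  (λ y∈p → x∈p∪q⁺ (inj₁ y∈p)) ,
  (λ y∈ → Data.Sum.fromInj₁ (λ y≡x → contradiction y≡x y≢x) (x∈p∪⁅y⁆⁻ p y∈))

agreeOff-─ : ∀ (p : Subset n) → AgreeOff x p (p - x)
agreeOff-─ p y≢x = (λ y∈p → x∈p∧x≢y⇒x∈p-y y∈p y≢x) , (proj₁ ∘ x∈p-y⁻ p)

agreeOff⇒x≡y : AgreeOff x p p′ → y ∈ p △ p′ → y ≡ x
agreeOff⇒x≡y {x = x} {p = p} {p′ = p′} {y = y} agree y∈ =
  decidable-stable (y ≟ x) λ y≢x → case x∈p△q⁻ p p′ y∈ of λ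
    { (inj₁ (y∈p , y∉p′)) → y∉p′ (proj₁ (agree y≢x) y∈p)
    ; (inj₂ (y∈p′ , y∉p)) → y∉p (proj₂ (agree y≢x) y∈p′) }

agreeOff⇒∣p△p′∣≡1 : AgreeOff x p p′ → x ∈ p △ p′ → ∣ p △ p′ ∣ ≡ 1
agreeOff⇒∣p△p′∣≡1 {x = x} agree x∈ = ≤-antisym
  (≤-trans (p⊆q⇒∣p∣≤∣q∣ λ y∈ → subst (_∈ ⁅ x ⁆) (sym (agreeOff⇒x≡y agree y∈)) (x∈⁅x⁆ x))
           (≤-reflexive (∣⁅x⁆∣≡1 x)))
  (x∈p⇒0<∣p∣ x∈)

agreeOff⇒∣p′△q∣<∣p△q∣ : ∀ q → AgreeOff x p p′ → x ∈ p △ q → x ∉ p′ △ q → ∣ p′ △ q ∣ < ∣ p △ q ∣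
agreeOff⇒∣p′△q∣<∣p△q∣ {x = x} {p = p} {p′ = p′} q agree x∈ x∉ =
  p⊂q⇒∣p∣<∣q∣ (p′△q⊆p△q , x , x∈ , x∉)
  where
  p′△q⊆p△q : p′ △ q ⊆ p △ q
  p′△q⊆p△q {y} y∈ with y ≟ x
  ... | yes refl = contradiction y∈ x∉
  ... | no  y≢x  = x∈p△q⁺ (Data.Sum.map (Data.Product.map₁ (proj₂ (agree y≢x)))
                                        (Data.Product.map₂ (λ y∉p′ → y∉p′ ∘ proj₁ (agree y≢x)))
                                        (x∈p△q⁻ p′ q y∈))

∣p△[p∪⁅x⁆]∣≡1 : ∀ (p : Subset n) → x ∉ p → ∣ p △ (p ∪ ⁅ x ⁆) ∣ ≡ 1
∣p△[p∪⁅x⁆]∣≡1 p x∉p = agreeOff⇒∣p△p′∣≡1 (agreeOff-∪⁅x⁆ p) (x∈p△q⁺ (inj₂ (x∈p∪q⁺ (inj₂ (x∈⁅x⁆ _)) , x∉p)))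

∣p△[p-x]∣≡1 : ∀ (p : Subset n) → x ∈ p → ∣ p △ (p - x) ∣ ≡ 1
∣p△[p-x]∣≡1 p x∈p = agreeOff⇒∣p△p′∣≡1 (agreeOff-─ p) (x∈p△q⁺ (inj₁ (x∈p , λ x∈p-x → proj₂ (x∈p-y⁻ p x∈p-x) refl)))

∣[p∪⁅x⁆]△q∣<∣p△q∣ : ∀ (p q : Subset n) → x ∉ p → x ∈ q → ∣ (p ∪ ⁅ x ⁆) △ q ∣ < ∣ p △ q ∣
∣[p∪⁅x⁆]△q∣<∣p△q∣ p q x∉p x∈q = agreeOff⇒∣p′△q∣<∣p△q∣ q (agreeOff-∪⁅x⁆ p)
  (x∈p△q⁺ (inj₂ (x∈q , x∉p)))
  (λ x∈ → case x∈p△q⁻ _ q x∈ of λ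
    { (inj₁ (_ , x∉q))  → x∉q x∈q
    ; (inj₂ (_ , x∉p∪)) → x∉p∪ (x∈p∪q⁺ (inj₂ (x∈⁅x⁆ _))) })

∣[p-x]△q∣<∣p△q∣ : ∀ (p q : Subset n) → x ∈ p → x ∉ q → ∣ (p - x) △ q ∣ < ∣ p △ q ∣
∣[p-x]△q∣<∣p△q∣ p q x∈p x∉q = agreeOff⇒∣p′△q∣<∣p△q∣ q (agreeOff-─ p)
  (x∈p△q⁺ (inj₁ (x∈p , x∉q)))
  (λ x∈ → case x∈p△q⁻ _ q x∈ of λ
    { (inj₁ (x∈p-x , _)) → proj₂ (x∈p-y⁻ p x∈p-x) refl
    ; (inj₂ (x∈q , _))   → x∉q x∈q })

∣p△q∣≡1⇒p∪⁅x⁆⊆q⊎q⊆p-x : ∀ (p q : Subset n) → ∣ p △ q ∣ ≡ 1 →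
                         ∃ λ x → (x ∉ p × p ∪ ⁅ x ⁆ ⊆ q) ⊎ (x ∈ p × q ⊆ p - x)
∣p△q∣≡1⇒p∪⁅x⁆⊆q⊎q⊆p-x p q ∣p△q∣≡1 with 0<∣p∣⇒Nonempty (p △ q) (≤-reflexive (sym ∣p△q∣≡1))
... | x , x∈p△q with x∈p△q⁻ p q x∈p△q
...   | inj₂ (x∈q , x∉p) = x , inj₁ (x∉p , p∪⁅x⁆⊆q)
  where
  p∪⁅x⁆⊆q : p ∪ ⁅ x ⁆ ⊆ q
  p∪⁅x⁆⊆q {y} y∈ with x∈p∪⁅y⁆⁻ p y∈
  ... | inj₂ refl = x∈q
  ... | inj₁ y∈p  = decidable-stable (y ∈? q) λ y∉q →
    x∉p (subst (_∈ p) (∣p∣≤1⇒x≡y (≤-reflexive ∣p△q∣≡1) (x∈p△q⁺ (inj₁ (y∈p , y∉q))) x∈p△q) y∈p)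
...   | inj₁ (x∈p , x∉q) = x , inj₂ (x∈p , q⊆p-x)
  where
  q⊆p-x : q ⊆ p - x
  q⊆p-x {y} y∈q = x∈p∧x≢y⇒x∈p-y
    (decidable-stable (y ∈? p) λ y∉p →
      x∉q (subst (_∈ q) (∣p∣≤1⇒x≡y (≤-reflexive ∣p△q∣≡1) (x∈p△q⁺ (inj₂ (y∈q , y∉p))) x∈p△q) y∈q))
    (λ { refl → x∉q y∈q })

first-or-none : ∀ {P : ℕ → Set} → Decidable P → ∀ m →
                (∀ {i} → i < m → ¬ P i) ⊎ ∃ λ j → j < m × P j × (∀ {i} → i < j → ¬ P i)
first-or-none P? ℕ.zero = inj₁ λ ()
first-or-none P? (suc m) with first-or-none P? m
... | inj₂ (j , j<m , Pj , first) = inj₂ (j , m<n⇒m<1+n j<m , Pj , first)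
... | inj₁ none with P? m
...   | yes Pm  = inj₂ (m , ≤-refl , Pm , none)
...   | no  ¬Pm = inj₁ λ i<1+m → case m≤n⇒m<n∨m≡n (≤-pred i<1+m) of λ
        { (inj₁ i<m)  → none i<m
        ; (inj₂ refl) → ¬Pm }

module _ (G : Graph n) where

  Adjacent : Fin n → Fin n → Set
  Adjacent u v = adj G u v ≡ true

  adjacent? : ∀ u v → Dec (Adjacent u v)
  adjacent? u v = adj G u v Bool.≟ true

  adjacent-sym : ∀ {u v} → Adjacent u v → Adjacent v u
  adjacent-sym {u} {v} = trans (Graph.sym G v u)

  adjacent-irrefl : ∀ {v} → ¬ Adjacent v v
  adjacent-irrefl {v} v~v with () ← trans (sym (Graph.irrefl G v)) v~v

  independent⇒¬adjacent : ∀ {I u v} → Independent G I → u ∈ I → v ∈ I → ¬ Adjacent u v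
  independent⇒¬adjacent ind u∈I v∈I u~v with () ← trans (sym (ind _ _ u∈I v∈I)) u~v

  AtMostOneNeighbourIn : Fin n → Subset n → Set
  AtMostOneNeighbourIn a T = ∀ {b c} → b ∈ T → Adjacent a b → c ∈ T → Adjacent a c → b ≡ c

  TwoNeighboursIn : Fin n → Subset n → Set
  TwoNeighboursIn a T = ∃₂ λ b c → b ∈ T × c ∈ T × b ≢ c × Adjacent a b × Adjacent a c

  atMostOneNeighbour-or-two : ∀ a T → AtMostOneNeighbourIn a T ⊎ TwoNeighboursIn a T
  atMostOneNeighbour-or-two a T with any? (λ b → b ∈? T ×-dec adjacent? a b)
  ... | no none = inj₁ λ b∈T a~b _ _ → contradiction (_ , b∈T , a~b) none
  ... | yes (b , b∈T , a~b) with any? (λ c → c ∈? T ×-dec adjacent? a c ×-dec ¬? (c ≟ b))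
  ...   | yes (c , c∈T , a~c , c≢b) = inj₂ (c , b , c∈T , b∈T , c≢b , a~c , a~b)
  ...   | no none = inj₁ λ c∈T a~c c′∈T a~c′ → trans (≡b c∈T a~c) (sym (≡b c′∈T a~c′))
    where
    ≡b : ∀ {c} → c ∈ T → Adjacent a c → c ≡ b
    ≡b {c} c∈T a~c = decidable-stable (c ≟ b) λ c≢b → none (c , c∈T , a~c , c≢b)

  atMostOneNeighbour? : ∀ a T → Dec (AtMostOneNeighbourIn a T)
  atMostOneNeighbour? a T with atMostOneNeighbour-or-two a T
  ... | inj₁ atMostOne = yes atMostOne
  ... | inj₂ (b , c , b∈T , c∈T , b≢c , a~b , a~c) = no λ atMostOne → b≢c (atMostOne b∈T a~b c∈T a~c)

  someAtMostOneNeighbour-or-allTwo :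
    ∀ A T → (∃ λ a → a ∈ A × AtMostOneNeighbourIn a T) ⊎ (∀ {a} → a ∈ A → TwoNeighboursIn a T)
  someAtMostOneNeighbour-or-allTwo A T with any? (λ a → a ∈? A ×-dec atMostOneNeighbour? a T)
  ... | yes found = inj₁ found
  ... | no  none  = inj₂ λ {a} a∈A → case atMostOneNeighbour-or-two a T of λ
        { (inj₁ atMostOne) → contradiction (a , a∈A , λ {b} {c} → atMostOne {b} {c}) none
        ; (inj₂ two)       → two }

  TriangleFree : Subset n → Set
  TriangleFree S = ∀ {x y z} → x ∈ S → y ∈ S → z ∈ S → Adjacent x y → Adjacent y z → ¬ Adjacent x z

  MinDegree≥2 : Subset n → Set
  MinDegree≥2 S = ∀ {x} → x ∈ S → TwoNeighboursIn x S

  record InducedPath (S : Subset n) (L : ℕ) : Set where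
    field
      vertex      : ℕ → Fin n
      member      : ∀ {i} → i < L → vertex i ∈ S
      injective   : ∀ {i j} → i < L → j < L → vertex i ≡ vertex j → i ≡ j
      consecutive : ∀ {i} → suc i < L → Adjacent (vertex i) (vertex (suc i))
      chordless   : ∀ {i j} → j < L → suc i < j → ¬ Adjacent (vertex i) (vertex j)

  open InducedPath

  inducedPath-length≤ : ∀ {S L} → InducedPath S L → L ≤ n
  inducedPath-length≤ P = injective⇒≤ {f = vertex P ∘ toℕ}
    λ {i} {j} eq → toℕ-injective (injective P (toℕ<n i) (toℕ<n j) eq)

  truncate : ∀ {S L L′} → L′ ≤ L → InducedPath S L → InducedPath S L′
  truncate L′≤L P = record
    { vertex      = vertex P
    ; member      = λ i<L′ → member P (<-≤-trans i<L′ L′≤L)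
    ; injective   = λ i<L′ j<L′ → injective P (<-≤-trans i<L′ L′≤L) (<-≤-trans j<L′ L′≤L)
    ; consecutive = λ i<L′ → consecutive P (<-≤-trans i<L′ L′≤L)
    ; chordless   = λ j<L′ → chordless P (<-≤-trans j<L′ L′≤L)
    }

  singleton : ∀ {S s} → s ∈ S → InducedPath S 1
  singleton {s = s} s∈S = record
    { vertex      = λ _ → s
    ; member      = λ _ → s∈S
    ; injective   = λ { (s≤s z≤n) (s≤s z≤n) _ → refl }
    ; consecutive = λ { (s≤s ()) }
    ; chordless   = λ { (s≤s z≤n) () }
    }

  _◂_ : Fin n → (ℕ → Fin n) → ℕ → Fin n
  (x ◂ f) ℕ.zero  = x
  (x ◂ f) (suc i) = f i

  module _ {S L} (P : InducedPath S L) {x} (x∉P : ∀ {i} → i < L → x ≢ vertex P i)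
           (x~P₀ : Adjacent x (vertex P 0)) where

    ◂-injective : ∀ {i j} → i < suc L → j < suc L → (x ◂ vertex P) i ≡ (x ◂ vertex P) j → i ≡ j
    ◂-injective {ℕ.zero} {ℕ.zero}  _           _           _  = refl
    ◂-injective {ℕ.zero} {suc j}   _           (s≤s j<L)   eq = contradiction eq (x∉P j<L)
    ◂-injective {suc i}  {ℕ.zero}  (s≤s i<L)   _           eq = contradiction (sym eq) (x∉P i<L)
    ◂-injective {suc i}  {suc j}   (s≤s i<L)   (s≤s j<L)   eq = cong suc (injective P i<L j<L eq)

    ◂-consecutive : ∀ {i} → suc i < suc L → Adjacent ((x ◂ vertex P) i) ((x ◂ vertex P) (suc i))
    ◂-consecutive {ℕ.zero} _         = x~P₀
    ◂-consecutive {suc i}  (s≤s i<L) = consecutive P i<L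

    ◂-chordless : ∀ {M} → (∀ {b} → 0 < b → b < M → ¬ Adjacent x (vertex P b)) →
                  ∀ {i j} → j < suc L → suc i < j → 0 < i ⊎ j ≤ M →
                  ¬ Adjacent ((x ◂ vertex P) i) ((x ◂ vertex P) j)
    ◂-chordless x≁P {ℕ.zero} {suc b} _         (s≤s 0<b) (inj₂ b<M) = x≁P 0<b b<M
    ◂-chordless x≁P {suc a}  {suc b} (s≤s b<L) (s≤s a<b) _          = chordless P b<L a<b

  inducedCycle : ∀ {k} (c : ℕ → Fin n) →
    (∀ {i j} → i < 3 + k → j < 3 + k → c i ≡ c j → i ≡ j) →
    (∀ {i} → suc i < 3 + k → Adjacent (c i) (c (suc i))) →
    Adjacent (c (2 + k)) (c 0) →
    -- no chords: i, j are neither consecutive nor the closing pair 0, 2 + k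
    (∀ {i j} → j < 3 + k → suc i < j → 0 < i ⊎ j ≤ 1 + k → ¬ Adjacent (c i) (c j)) →
    InducedCycle G (3 + k)
  inducedCycle {k} c injective consecutive closing chordless = record
    { k≥3      = s≤s (s≤s (s≤s z≤n))
    ; c        = c ∘ toℕ
    ; inj      = λ {p} {q} eq → toℕ-injective (injective (toℕ<n p) (toℕ<n q) eq)
    ; edges    = edges
    ; nonedges = nonedges
    }
    where
    next : ∀ p q → CycNext p q → Adjacent (c (toℕ p)) (c (toℕ q))
    next p q (inj₁ q≡1+p) rewrite q≡1+p = consecutive (subst (_< 3 + k) q≡1+p (toℕ<n q))
    next p q (inj₂ (1+p≡3+k , q≡0)) rewrite q≡0 | suc-injective 1+p≡3+k = closing

    edges : ∀ p q → CycAdj p q → Adjacent (c (toℕ p)) (c (toℕ q))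
    edges p q (inj₁ p→q) = next p q p→q
    edges p q (inj₂ q→p) = adjacent-sym (next q p q→p)

    not-closing : ∀ p q → ¬ CycNext q p → 0 < toℕ p ⊎ toℕ q ≤ 1 + k
    not-closing zero    q ¬q→p = inj₂ (≤-pred (≤-pred (≤∧≢⇒< (toℕ<n q) λ eq → ¬q→p (inj₂ (eq , refl)))))
    not-closing (suc p) q _     = inj₁ z<s

    ordered : ∀ {p q} → toℕ p < toℕ q → ¬ CycAdj p q → ¬ Adjacent (c (toℕ p)) (c (toℕ q))
    ordered {p} {q} p<q ¬p~q = chordless (toℕ<n q)
      (≤∧≢⇒< p<q λ eq → ¬p~q (inj₁ (inj₁ (sym eq))))
      (not-closing p q (¬p~q ∘ inj₂))

    nonedges : ∀ p q → p ≢ q → ¬ CycAdj p q → adj G (c (toℕ p)) (c (toℕ q)) ≡ false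
    nonedges p q p≢q ¬p~q with <-cmp (toℕ p) (toℕ q)
    ... | tri< p<q _ _ = ¬-not (ordered p<q ¬p~q)
    ... | tri≈ _ p≡q _ = contradiction (toℕ-injective p≡q) p≢q
    ... | tri> _ _ q<p = ¬-not (ordered q<p (¬p~q ∘ Data.Sum.swap) ∘ adjacent-sym)

  module _ (chordal : Chordal G) {S} (triangleFree : TriangleFree S) (minDegree : MinDegree≥2 S) where

    apex : ∀ {m} (P : InducedPath S (suc m)) →
           ∃ λ x → x ∈ S × Adjacent x (vertex P 0) × x ≢ vertex P 1
    apex P with minDegree (member P z<s)
    ... | y , z , y∈S , z∈S , y≢z , P₀~y , P₀~z with y ≟ vertex P 1
    ...   | no  y≢P₁ = y , y∈S , adjacent-sym P₀~y , y≢P₁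
    ...   | yes y≡P₁ = z , z∈S , adjacent-sym P₀~z , λ z≡P₁ → y≢z (trans y≡P₁ (sym z≡P₁))

    module Extend {m} (P : InducedPath S (suc m)) {x} (x∈S : x ∈ S)
                  (x~P₀ : Adjacent x (vertex P 0)) (x≢P₁ : x ≢ vertex P 1) where

      x∉P : ∀ {i} → i < suc m → x ≢ vertex P i
      x∉P {ℕ.zero}        _   eq = adjacent-irrefl (subst (λ v → Adjacent v (vertex P 0)) eq x~P₀)
      x∉P {suc ℕ.zero}    _   eq = x≢P₁ eq
      x∉P {suc (suc i)} i<1+m eq = chordless P i<1+m (s≤s (s≤s z≤n))
        (adjacent-sym (subst (λ v → Adjacent v (vertex P 0)) eq x~P₀))

      prepended : (∀ {i} → i < m → ¬ Adjacent x (vertex P (suc i))) → InducedPath S (suc (suc m))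
      prepended x≁P = record
        { vertex      = x ◂ vertex P
        ; member      = λ { {ℕ.zero} _ → x∈S ; {suc i} (s≤s i<1+m) → member P i<1+m }
        ; injective   = ◂-injective P x∉P x~P₀
        ; consecutive = ◂-consecutive P x∉P x~P₀
        ; chordless   = λ j< 1+i<j → ◂-chordless P x∉P x~P₀ x≁P′ j< 1+i<j (inj₂ (≤-pred j<))
        }
        where
        x≁P′ : ∀ {b} → 0 < b → b < suc m → ¬ Adjacent x (vertex P b)
        x≁P′ {suc b} _ (s≤s b<m) = x≁P b<m

      cycle : ∀ {j} → j < m → Adjacent x (vertex P (suc j)) →
              (∀ {i} → i < j → ¬ Adjacent x (vertex P (suc i))) → InducedCycle G (3 + j)
      cycle {j} j<m x~Pⱼ₊₁ first = inducedCycle (x ◂ vertex P)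
        (◂-injective Q x∉Q x~P₀) (◂-consecutive Q x∉Q x~P₀) (adjacent-sym x~Pⱼ₊₁)
        (◂-chordless Q x∉Q x~P₀ x≁Q)
        where
        Q : InducedPath S (2 + j)
        Q = truncate (s≤s j<m) P
        x∉Q : ∀ {i} → i < 2 + j → x ≢ vertex P i
        x∉Q i<2+j = x∉P (<-≤-trans i<2+j (s≤s j<m))
        x≁Q : ∀ {b} → 0 < b → b < suc j → ¬ Adjacent x (vertex P b)
        x≁Q {suc b} _ (s≤s b<j) = first b<j

      no-chord : ∀ {j} → j < m → Adjacent x (vertex P (suc j)) →
                 ¬ (∀ {i} → i < j → ¬ Adjacent x (vertex P (suc i)))
      no-chord j<m x~Pⱼ₊₁ first with chordal _ (cycle j<m x~Pⱼ₊₁ first)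
      ... | refl = triangleFree x∈S (member P z<s) (member P (s≤s j<m))
                     x~P₀ (consecutive P (s≤s j<m)) x~Pⱼ₊₁

      extended : InducedPath S (suc (suc m))
      extended with first-or-none (λ i → adjacent? x (vertex P (suc i))) m
      ... | inj₁ x≁P                         = prepended x≁P
      ... | inj₂ (j , j<m , x~Pⱼ₊₁ , first) = ⊥-elim (no-chord j<m x~Pⱼ₊₁ first)

    inducedPath : ∀ {s} → s ∈ S → ∀ m → InducedPath S (suc m)
    inducedPath s∈S ℕ.zero  = singleton s∈S
    inducedPath s∈S (suc m) =
      let P = inducedPath s∈S m ; _ , x∈S , x~P₀ , x≢P₁ = apex P
      in Extend.extended P x∈S x~P₀ x≢P₁

    triangleFree-minDegree≥2-empty : Empty S
    triangleFree-minDegree≥2-empty (s , s∈S) = <-irrefl refl (inducedPath-length≤ (inducedPath s∈S n))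

  independent-⊆ : ∀ {I J} → I ⊆ J → Independent G J → Independent G I
  independent-⊆ I⊆J indJ u v u∈I v∈I = indJ u v (I⊆J u∈I) (I⊆J v∈I)

  twoNeighbours-⊆ : ∀ {a T T′} → T ⊆ T′ → TwoNeighboursIn a T → TwoNeighboursIn a T′
  twoNeighbours-⊆ T⊆T′ (b , c , b∈T , c∈T , b≢c , a~b , a~c) = b , c , T⊆T′ b∈T , T⊆T′ c∈T , b≢c , a~b , a~c

  atMostOneNeighbour-─ : ∀ {a b T} → ¬ Adjacent a b →
                         AtMostOneNeighbourIn a (T - b) → AtMostOneNeighbourIn a T
  atMostOneNeighbour-─ {a} {b} a≁b atMostOne c∈T a~c c′∈T a~c′ =
    atMostOne (x∈p∧x≢y⇒x∈p-y c∈T (≢b a~c)) a~c (x∈p∧x≢y⇒x∈p-y c′∈T (≢b a~c′)) a~c′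
    where
    ≢b : ∀ {c} → Adjacent a c → c ≢ b
    ≢b a~c refl = a≁b a~c

  bipartite-triangleFree : ∀ {A B} → Independent G A → Independent G B → TriangleFree (A ∪ B)
  bipartite-triangleFree {A} {B} indA indB x∈ y∈ z∈ x~y y~z x~z
    with x∈p∪q⁻ A B x∈ | x∈p∪q⁻ A B y∈ | x∈p∪q⁻ A B z∈
  ... | inj₁ x∈A | inj₁ y∈A | _        = independent⇒¬adjacent indA x∈A y∈A x~y
  ... | inj₂ x∈B | inj₂ y∈B | _        = independent⇒¬adjacent indB x∈B y∈B x~y
  ... | _        | inj₁ y∈A | inj₁ z∈A = independent⇒¬adjacent indA y∈A z∈A y~z
  ... | _        | inj₂ y∈B | inj₂ z∈B = independent⇒¬adjacent indB y∈B z∈B y~z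
  ... | inj₁ x∈A | inj₂ _   | inj₁ z∈A = independent⇒¬adjacent indA x∈A z∈A x~z
  ... | inj₂ x∈B | inj₁ _   | inj₂ z∈B = independent⇒¬adjacent indB x∈B z∈B x~z

  bipartite-atMostOneNeighbour : Chordal G → ∀ {A B} → Independent G A → Independent G B → Nonempty A →
    (∀ {a} → a ∈ A → TwoNeighboursIn a B) → ∃ λ b → b ∈ B × AtMostOneNeighbourIn b A
  bipartite-atMostOneNeighbour chordal {A} {B} indA indB (a , a∈A) allA
    with someAtMostOneNeighbour-or-allTwo B A
  ... | inj₁ found = found
  ... | inj₂ allB  = ⊥-elim (triangleFree-minDegree≥2-empty chordal
          (bipartite-triangleFree indA indB) minDegree (a , x∈p∪q⁺ (inj₁ a∈A)))
    where
    minDegree : MinDegree≥2 (A ∪ B)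
    minDegree x∈ = case x∈p∪q⁻ A B x∈ of λ
      { (inj₁ x∈A) → twoNeighbours-⊆ (q⊆p∪q A B) (allA x∈A)
      ; (inj₂ x∈B) → twoNeighbours-⊆ (p⊆p∪q B) (allB x∈B) }

  atMostOneNeighbour-exists : Chordal G → ∀ {m A B} → ∣ B ∣ ≡ m → Independent G A → Independent G B →
    ∣ B ∣ ≤ ∣ A ∣ → Nonempty A → ∃ λ a → a ∈ A × AtMostOneNeighbourIn a B
  atMostOneNeighbour-exists chordal {ℕ.zero} ∣B∣≡0 _ _ _ (a , a∈A) =
    a , a∈A , λ b∈B → contradiction ∣B∣≡0 (>⇒≢ (x∈p⇒0<∣p∣ b∈B))
  atMostOneNeighbour-exists chordal {suc m} {A} {B} ∣B∣≡1+m indA indB ∣B∣≤∣A∣ neA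
    with someAtMostOneNeighbour-or-allTwo A B
  ... | inj₁ found = found
  ... | inj₂ allA with bipartite-atMostOneNeighbour chordal indA indB neA allA
  ...   | b , b∈B , b-atMostOne with any? (λ a → a ∈? A ×-dec adjacent? b a)
  ...     | no b≁A =
    let a , a∈A , atMostOne = atMostOneNeighbour-exists chordal ∣B-b∣≡m indA
                                (independent-⊆ (p─q⊆p B ⁅ b ⁆) indB)
                                (≤-trans (∣p─q∣≤∣p∣ B ⁅ b ⁆) ∣B∣≤∣A∣) neA
    in a , a∈A , atMostOneNeighbour-─ (λ a~b → b≁A (a , a∈A , adjacent-sym a~b)) atMostOne
    where
    ∣B-b∣≡m : ∣ B - b ∣ ≡ m
    ∣B-b∣≡m = suc-injective (trans (1+∣p-x∣≡∣p∣ B b∈B) ∣B∣≡1+m)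
  ...     | yes (a₁ , a₁∈A , b~a₁) =
    let a , a∈A-a₁ , atMostOne = atMostOneNeighbour-exists chordal ∣B-b∣≡m
                                   (independent-⊆ (p─q⊆p A ⁅ a₁ ⁆) indA)
                                   (independent-⊆ (p─q⊆p B ⁅ b ⁆) indB)
                                   ∣B-b∣≤∣A-a₁∣ (0<∣p∣⇒Nonempty (A - a₁) (<-≤-trans 0<∣B-b∣ ∣B-b∣≤∣A-a₁∣))
        a∈A , a≢a₁ = x∈p-y⁻ A a∈A-a₁
    in a , a∈A , atMostOneNeighbour-─ (λ a~b → a≢a₁ (b-atMostOne a∈A (adjacent-sym a~b) a₁∈A b~a₁))
                   atMostOne
    where
    ∣B-b∣≡m : ∣ B - b ∣ ≡ m
    ∣B-b∣≡m = suc-injective (trans (1+∣p-x∣≡∣p∣ B b∈B) ∣B∣≡1+m)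
    ∣B-b∣≤∣A-a₁∣ : ∣ B - b ∣ ≤ ∣ A - a₁ ∣
    ∣B-b∣≤∣A-a₁∣ = ≤-pred (subst₂ _≤_ (sym (1+∣p-x∣≡∣p∣ B b∈B)) (sym (1+∣p-x∣≡∣p∣ A a₁∈A)) ∣B∣≤∣A∣)
    0<∣B-b∣ : 0 < ∣ B - b ∣
    0<∣B-b∣ with allA a₁∈A
    ... | y , z , y∈B , z∈B , y≢z , _ with y ≟ b
    ...   | no  y≢b = x∈p⇒0<∣p∣ (x∈p∧x≢y⇒x∈p-y y∈B y≢b)
    ...   | yes y≡b = x∈p⇒0<∣p∣ (x∈p∧x≢y⇒x∈p-y z∈B λ z≡b → y≢z (trans y≡b (sym z≡b)))

Free : Graph n → Subset n → Fin n → Set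
Free G I v = v ∉ I × (∀ u → u ∈ I → adj G u v ≡ false)

∪⁅⁆-independent : ∀ (G : Graph n) {I v} → Independent G I → Free G I v → Independent G (I ∪ ⁅ v ⁆)
∪⁅⁆-independent G {I} {v} indI (_ , v-free) x y x∈ y∈
  with x∈p∪⁅y⁆⁻ I x∈ | x∈p∪⁅y⁆⁻ I y∈
... | inj₁ x∈I  | inj₁ y∈I  = indI x y x∈I y∈I
... | inj₁ x∈I  | inj₂ refl = v-free x x∈I
... | inj₂ refl | inj₁ y∈I  = trans (Graph.sym G v y) (v-free y y∈I)
... | inj₂ refl | inj₂ refl = Graph.irrefl G v

maximal-or-free : ∀ (G : Graph n) {I} → Independent G I → MaximalIndependent G I ⊎ ∃ (Free G I)
maximal-or-free G {I} indI
  with any? (λ v → ¬? (v ∈? I) ×-dec all? (λ u → u ∈? I →-dec (adj G u v Bool.≟ false)))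
... | yes free = inj₂ free
... | no  none = inj₁ (indI , λ v v∉I indI∪v → none (v , v∉I , λ u u∈I →
        indI∪v u v (x∈p∪q⁺ (inj₁ u∈I)) (x∈p∪q⁺ (inj₂ (x∈⁅x⁆ v)))))

module _ {G : Graph n} {l : ℕ} {I₀ : Subset n} where

  reach-independent : ∀ {I} → Reach G l I₀ I → Independent G I
  reach-independent (start indI _)    = indI
  reach-independent (step _ indI _ _) = indI

  reach-size : ∀ {I} → Reach G l I₀ I → l ≤ ∣ I ∣
  reach-size (start _ l≤∣I∣)    = l≤∣I∣
  reach-size (step _ _ l≤∣I∣ _) = l≤∣I∣

  reach-add : ∀ {I v} → Reach G l I₀ I → Free G I v → Reach G l I₀ (I ∪ ⁅ v ⁆)
  reach-add {I} {v} r v-free@(v∉I , _) =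
    step r (∪⁅⁆-independent G (reach-independent r) v-free)
      (≤-trans (reach-size r) (∣p∣≤∣p∪q∣ I ⁅ v ⁆)) (∣p△[p∪⁅x⁆]∣≡1 I v∉I)

  reach-remove : ∀ {I u} → Reach G l I₀ I → u ∈ I → l ≤ ∣ I - u ∣ → Reach G l I₀ (I - u)
  reach-remove {I} {u} r u∈I l≤∣I-u∣ =
    step r (independent-⊆ G (p─q⊆p I ⁅ u ⁆) (reach-independent r)) l≤∣I-u∣ (∣p△[p-x]∣≡1 I u∈I)

  reach-frozen : MaximalIndependent G I₀ → ∣ I₀ ∣ ≡ l → ∀ {J} → Reach G l I₀ J → J ≡ I₀
  reach-frozen _ _ (start _ _) = refl
  reach-frozen maximal ∣I₀∣≡l (step {K = K} r indK l≤∣K∣ ∣J△K∣≡1)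
    with reach-frozen maximal ∣I₀∣≡l r
  ... | refl with ∣p△q∣≡1⇒p∪⁅x⁆⊆q⊎q⊆p-x I₀ K ∣J△K∣≡1
  ...   | x , inj₁ (x∉I₀ , I₀∪⁅x⁆⊆K) = ⊥-elim (proj₂ maximal x x∉I₀ (independent-⊆ G I₀∪⁅x⁆⊆K indK))
  ...   | x , inj₂ (x∈I₀ , K⊆I₀-x)  = ⊥-elim (<⇒≱
          (≤-<-trans (p⊆q⇒∣p∣≤∣q∣ K⊆I₀-x) (x∈p⇒∣p-x∣<∣p∣ x∈I₀))
          (subst (_≤ ∣ K ∣) (sym ∣I₀∣≡l) l≤∣K∣))

  reach-above : Independent G I₀ → l ≤ ∣ I₀ ∣ → ¬ (MaximalIndependent G I₀ × ∣ I₀ ∣ ≡ l) →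
                ∃ λ I → Reach G l I₀ I × suc l ≤ ∣ I ∣
  reach-above indI₀ l≤∣I₀∣ ¬frozen with m≤n⇒m<n∨m≡n l≤∣I₀∣
  ... | inj₁ l<∣I₀∣ = I₀ , start indI₀ l≤∣I₀∣ , l<∣I₀∣
  ... | inj₂ l≡∣I₀∣ with maximal-or-free G indI₀
  ...   | inj₁ maximal = ⊥-elim (¬frozen (maximal , sym l≡∣I₀∣))
  ...   | inj₂ (v , v-free) = I₀ ∪ ⁅ v ⁆ , reach-add (start indI₀ l≤∣I₀∣) v-free ,
          ≤-reflexive (sym (trans (∣p∪⁅x⁆∣≡1+∣p∣ I₀ (proj₁ v-free)) (cong suc (sym l≡∣I₀∣))))

  module _ (chordal : Chordal G) {J} (indJ : Independent G J) (1+l≤∣J∣ : suc l ≤ ∣ J ∣) where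

    Closer : Subset n → Set
    Closer I = ∃ λ I′ → Reach G l I₀ I′ × suc l ≤ ∣ I′ ∣ × ∣ I′ △ J ∣ < ∣ I △ J ∣

    closer-by-adding : ∀ {I v} → Reach G l I₀ I → suc l ≤ ∣ I ∣ → v ∈ J → Free G I v → Closer I
    closer-by-adding {I} {v} r 1+l≤∣I∣ v∈J v-free@(v∉I , _) =
      I ∪ ⁅ v ⁆ , reach-add r v-free ,
      ≤-trans 1+l≤∣I∣ (∣p∣≤∣p∪q∣ I ⁅ v ⁆) ,
      ∣[p∪⁅x⁆]△q∣<∣p△q∣ I J v∉I v∈J

    closer-by-removing : ∀ {I u} → Reach G l I₀ I → 2 + l ≤ ∣ I ∣ → u ∈ I → u ∉ J → Closer I
    closer-by-removing {I} {u} r 2+l≤∣I∣ u∈I u∉J =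
      I - u , reach-remove r u∈I (<⇒≤ 1+l≤∣I-u∣) , 1+l≤∣I-u∣ , ∣[p-x]△q∣<∣p△q∣ I J u∈I u∉J
      where
      1+l≤∣I-u∣ : suc l ≤ ∣ I - u ∣
      1+l≤∣I-u∣ = ≤-pred (subst (2 + l ≤_) (sym (1+∣p-x∣≡∣p∣ I u∈I)) 2+l≤∣I∣)

    closer-by-exchanging : ∀ {I a} → Reach G l I₀ I → suc l ≤ ∣ I ∣ → a ∈ J → a ∉ I →
                           AtMostOneNeighbourIn G a (I ─ J) → Closer I
    closer-by-exchanging {I} {a} r 1+l≤∣I∣ a∈J a∉I atMostOne
      with any? (λ w → w ∈? I ×-dec adjacent? G w a)
    ... | no a-free = closer-by-adding r 1+l≤∣I∣ a∈J
                        (a∉I , λ w w∈I → ¬-not λ w~a → a-free (w , w∈I , w~a))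
    ... | yes (u , u∈I , u~a) =
      (I - u) ∪ ⁅ a ⁆ ,
      reach-add (reach-remove r u∈I (≤-pred 1+l≤1+∣I-u∣)) (a∉I-u , a-free) ,
      ≤-trans 1+l≤1+∣I-u∣ (≤-reflexive (sym (∣p∪⁅x⁆∣≡1+∣p∣ (I - u) a∉I-u))) ,
      <-trans (∣[p∪⁅x⁆]△q∣<∣p△q∣ (I - u) J a∉I-u a∈J) (∣[p-x]△q∣<∣p△q∣ I J u∈I (∉J u~a))
      where
      a∉I-u : a ∉ I - u
      a∉I-u = a∉I ∘ proj₁ ∘ x∈p-y⁻ I
      ∉J : ∀ {w} → Adjacent G w a → w ∉ J
      ∉J w~a w∈J = independent⇒¬adjacent G indJ w∈J a∈J w~a
      a-free : ∀ w → w ∈ I - u → adj G w a ≡ false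
      a-free w w∈I-u with x∈p-y⁻ I w∈I-u
      ... | w∈I , w≢u = ¬-not λ w~a → w≢u (atMostOne
              (x∈p∧x∉q⇒x∈p─q w∈I (∉J w~a)) (adjacent-sym G w~a)
              (x∈p∧x∉q⇒x∈p─q u∈I (∉J u~a)) (adjacent-sym G u~a))
      1+l≤1+∣I-u∣ : suc l ≤ suc ∣ I - u ∣
      1+l≤1+∣I-u∣ = subst (suc l ≤_) (sym (1+∣p-x∣≡∣p∣ I u∈I)) 1+l≤∣I∣

    equal-or-closer : ∀ {I} → Reach G l I₀ I → suc l ≤ ∣ I ∣ → I ≡ J ⊎ Closer I
    equal-or-closer {I} r 1+l≤∣I∣ with nonempty? (I ─ J) | nonempty? (J ─ I)
    ... | no I─J≡∅ | no J─I≡∅ = inj₁ (⊆-antisym (Empty[p─q]⇒p⊆q I J I─J≡∅) (Empty[p─q]⇒p⊆q J I J─I≡∅))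
    ... | no I─J≡∅ | yes (v , v∈J─I) =
      let v∈J , v∉I = x∈p─q⁻ J I v∈J─I
      in inj₂ (closer-by-adding r 1+l≤∣I∣ v∈J
                 (v∉I , λ u u∈I → indJ u v (Empty[p─q]⇒p⊆q I J I─J≡∅ u∈I) v∈J))
    ... | yes (u , u∈I─J) | _ with 2 + l ≤? ∣ I ∣
    ...   | yes 2+l≤∣I∣ =
      let u∈I , u∉J = x∈p─q⁻ I J u∈I─J in inj₂ (closer-by-removing r 2+l≤∣I∣ u∈I u∉J)
    ...   | no  2+l≰∣I∣ =
      let a , a∈J─I , atMostOne = atMostOneNeighbour-exists G chordal refl
            (independent-⊆ G (p─q⊆p J I) indJ) (independent-⊆ G (p─q⊆p I J) (reach-independent r))
            ∣I─J∣≤∣J─I∣ (0<∣p∣⇒Nonempty (J ─ I) (<-≤-trans (x∈p⇒0<∣p∣ u∈I─J) ∣I─J∣≤∣J─I∣))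
          a∈J , a∉I = x∈p─q⁻ J I a∈J─I
      in inj₂ (closer-by-exchanging r 1+l≤∣I∣ a∈J a∉I atMostOne)
      where
      ∣I─J∣≤∣J─I∣ : ∣ I ─ J ∣ ≤ ∣ J ─ I ∣
      ∣I─J∣≤∣J─I∣ = ∣p∣≤∣q∣⇒∣p─q∣≤∣q─p∣ I J (≤-trans (≤-pred (≰⇒> 2+l≰∣I∣)) 1+l≤∣J∣)

    reach-target : ∀ {I} → Acc _<_ ∣ I △ J ∣ → Reach G l I₀ I → suc l ≤ ∣ I ∣ → Reach G l I₀ J
    reach-target (acc rec) r 1+l≤∣I∣ with equal-or-closer r 1+l≤∣I∣
    ... | inj₁ refl = r
    ... | inj₂ (I′ , r′ , 1+l≤∣I′∣ , closer) = reach-target (rec closer) r′ 1+l≤∣I′∣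

lemma2 : ∀ {n} (G : Graph n) (l : ℕ) (Iini Imax : Subset n) →
    Chordal G → Independent G Iini → l ≤ ∣ Iini ∣ → MaximumIndependent G Imax →
    ((MaximalIndependent G Iini × ∣ Iini ∣ ≡ l) → Solution G l Iini Iini) ×
    (¬ (MaximalIndependent G Iini × ∣ Iini ∣ ≡ l) → Solution G l Iini Imax)
lemma2 G l Iini Imax chordal indIini l≤∣Iini∣ (indImax , maximum) = frozen , unfrozen
  where
  frozen : MaximalIndependent G Iini × ∣ Iini ∣ ≡ l → Solution G l Iini Iini
  frozen (maximal , ∣Iini∣≡l) =
    start indIini l≤∣Iini∣ , λ J r → ≤-reflexive (cong ∣_∣ (reach-frozen maximal ∣Iini∣≡l r))

  unfrozen : ¬ (MaximalIndependent G Iini × ∣ Iini ∣ ≡ l) → Solution G l Iini Imax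
  unfrozen ¬frozen =
    let I , r , 1+l≤∣I∣ = reach-above indIini l≤∣Iini∣ ¬frozen
        1+l≤∣Imax∣ = ≤-trans 1+l≤∣I∣ (maximum I (reach-independent r))
    in reach-target chordal indImax 1+l≤∣Imax∣ (<-wellFounded _) r 1+l≤∣I∣ ,
       λ J r′ → maximum J (reach-independent r′)
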